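{- Let $\mathsf{D}$ and $\mathsf{S}$ be optiongraphs. If some quotient $\mathsf{D}/\theta$ (with $\theta$ a congruence relation on $\mathsf{D}$) is isomorphic to some quotient $\mathsf{S}/\psi$ (with $\psi$ a congruence relation on $\mathsf{S}$), then the minimum quotients $\mathsf{D}/{\bowtie_{\mathsf{D}}}$ and $\mathsf{S}/{\bowtie_{\mathsf{S}}}$ are isomorphic.
   Context: An optiongraph is a nonempty set $\mathsf{D}$ (of positions, possibly infinite) together with an option function $\mathrm{Opt}_{\mathsf{D}}:\mathsf{D}\to 2^{\mathsf{D}}$. A function $f:\mathsf{C}\to\mathsf{D}$ is option preserving if $\mathrm{Opt}_{\mathsf{D}}(f(p))=f(\mathrm{Opt}_{\mathsf{C}}(p))$ for all $p$; an isomorphism is a bijective option-preserving map. For an equivalence relation $\theta$, write $[p]$ for the class of $p$ and $[S]:=\{[s]\mid s\in S\}$. An equivalence relation on an optiongraph is a congruence relation if $p\mathrel{\theta}q$ implies $[\mathrm{Opt}(p)]=[\mathrm{Opt}(q)]$. For an optiongraph $\mathsf{E}$, the union $\bowtie_{\mathsf{E}}$ of all congruence relations on $\mathsf{E}$ is itself a congruence relation (the maximum one). For a congruence relation $\theta$, the quotient optiongraph $\mathsf{D}/\theta$ is the set of classes with option function $\mathrm{Opt}_{\mathsf{D}/\theta}([p]):=[\mathrm{Opt}_{\mathsf{D}}(p)]$; $\mathsf{E}/{\bowtie_{\mathsf{E}}}$ is the minimum quotient of $\mathsf{E}$. -}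

module Defs where

open import Level using (Level; 0ℓ; suc)
open import Data.Product using (Σ; ∃; _×_; _,_)
open import Relation.Binary.Core using (Rel)
open import Relation.Binary.Structures using (IsEquivalence)

record Optiongraph : Set₁ where
  field
    Pos      : Set
    nonempty : Pos
    Opt      : Pos → Pos → Set   -- Opt p q  means  q ∈ Opt(p)

open Optiongraph public

-- [A] = [B] for subsets A, B of D (as sets of θ-classes):
-- every element of A is θ-related to some element of B and vice versa.
SameClasses : ∀ {ℓ} {D : Set} → Rel D ℓ → (D → Set) → (D → Set) → Set ℓ
SameClasses {D = D} θ A B =
  ((a : D) → A a → ∃ λ b → B b × θ a b) ×
  ((b : D) → B b → ∃ λ a → A a × θ a b)

IsCongruence : ∀ {ℓ} (G : Optiongraph) → Rel (Pos G) ℓ → Set ℓ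
IsCongruence G θ =
  IsEquivalence θ ×
  ((p q : Pos G) → θ p q → SameClasses θ (Opt G p) (Opt G q))

-- The union ⋈ of all congruence relations on G
-- (a relation on Pos G being a subset of Pos G × Pos G, i.e. a Rel (Pos G) 0ℓ).
⋈ : (G : Optiongraph) → Rel (Pos G) (suc 0ℓ)
⋈ G p q = ∃ λ (θ : Rel (Pos G) 0ℓ) → IsCongruence G θ × θ p q

-- The quotient D/θ is represented as the setoid (Pos D, θ) with option function
-- Opt_{D/θ}([p]) = [Opt_D(p)].  A map of quotients D/θ → S/ψ is given on
-- representatives by f : Pos D → Pos S respecting θ and ψ.
record QuotIso {ℓ₁ ℓ₂ : Level} (D : Optiongraph) (θ : Rel (Pos D) ℓ₁)
               (S : Optiongraph) (ψ : Rel (Pos S) ℓ₂) : Set (ℓ₁ Level.⊔ ℓ₂) where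
  field
    f          : Pos D → Pos S
    well-def   : ∀ p q → θ p q → ψ (f p) (f q)
    injective  : ∀ p q → ψ (f p) (f q) → θ p q
    surjective : ∀ s → ∃ λ p → ψ (f p) s
    -- Opt_{S/ψ}([f p]) = { [f p'] | [p'] ∈ Opt_{D/θ}([p]) },
    -- i.e. [Opt_S(f p)]_ψ = [ f(Opt_D(p)) ]_ψ
    opt-pres   : ∀ p →
      ((s : Pos S) → Opt S (f p) s → ∃ λ p' → Opt D p p' × ψ s (f p')) ×
      ((p' : Pos D) → Opt D p p' → ∃ λ s → Opt S (f p) s × ψ (f p') s)

{-# OPTIONS --safe #-}
-- If f : D → S preserves options up to a congruence ψ, then f reflects the
-- maximum congruence: for a congruence σ on S the equivalence closure of
-- σ ∪ ψ is again a congruence, and its pullback along f is a congruence on D.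
-- Applied to the isomorphism and to its inverse, this makes [p] ↦ [f p] well
-- defined and injective on ⋈-classes; surjectivity and option preservation
-- are inherited from the given isomorphism because ψ ⊆ ⋈ S.
module Submission where

open import Defs
open import Level using (Level; 0ℓ)
open import Data.Product using (∃; _×_; _,_; proj₁; proj₂)
open import Data.Sum using (inj₁; inj₂)
open import Function.Base using (_∘_; _on_)
open import Relation.Binary.Core using (Rel; _⇒_)
open import Relation.Binary.Definitions using (Reflexive; Symmetric; Transitive)
open import Relation.Binary.Structures using (IsEquivalence)
open import Relation.Binary.Construct.Union using (_∪_)
open import Relation.Binary.Construct.Closure.Equivalence as EqClosure
  using (EqClosure)
open import Relation.Binary.Construct.Closure.ReflexiveTransitive using (ε; _◅_)
open import Relation.Binary.Construct.Closure.Symmetric using (fwd; bwd)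
import Relation.Binary.Construct.On as On

private
  variable
    ℓ ℓ′ : Level
    X : Set
    A B C : X → Set

module _ {θ : Rel X ℓ} where

  SameClasses-refl : Reflexive θ → SameClasses θ A A
  SameClasses-refl refl = (λ a a∈A → a , a∈A , refl) , (λ b b∈B → b , b∈B , refl)

  SameClasses-sym : Symmetric θ → SameClasses θ A B → SameClasses θ B A
  SameClasses-sym sym (A⊆B , B⊆A) =
    (λ b b∈B → let a , a∈A , a~b = B⊆A b b∈B in a , a∈A , sym a~b) ,
    (λ a a∈A → let b , b∈B , a~b = A⊆B a a∈A in b , b∈B , sym a~b)

  SameClasses-trans : Transitive θ →
                      SameClasses θ A B → SameClasses θ B C → SameClasses θ A C
  SameClasses-trans trans (A⊆B , B⊆A) (B⊆C , C⊆B) =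
    (λ a a∈A → let b , b∈B , a~b = A⊆B a a∈A
                   c , c∈C , b~c = B⊆C b b∈B
               in c , c∈C , trans a~b b~c) ,
    (λ c c∈C → let b , b∈B , b~c = C⊆B c c∈C
                   a , a∈A , a~b = B⊆A b b∈B
               in a , a∈A , trans a~b b~c)

  SameClasses-mono : {θ′ : Rel X ℓ′} → θ ⇒ θ′ → SameClasses θ A B → SameClasses θ′ A B
  SameClasses-mono θ⇒θ′ (A⊆B , B⊆A) =
    (λ a a∈A → let b , b∈B , a~b = A⊆B a a∈A in b , b∈B , θ⇒θ′ a~b) ,
    (λ b b∈B → let a , a∈A , a~b = B⊆A b b∈B in a , a∈A , θ⇒θ′ a~b)

IsCompatible : (G : Optiongraph) → Rel (Pos G) ℓ → Set ℓ
IsCompatible G θ = (p q : Pos G) → θ p q → SameClasses θ (Opt G p) (Opt G q)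

eqClosure-isCompatible : (G : Optiongraph) {R : Rel (Pos G) ℓ} →
  (∀ p q → R p q → SameClasses (EqClosure R) (Opt G p) (Opt G q)) →
  IsCompatible G (EqClosure R)
eqClosure-isCompatible G {R} R-compat = go
  where
  open IsEquivalence (EqClosure.isEquivalence R)

  go : IsCompatible G (EqClosure R)
  go p .p ε              = SameClasses-refl refl
  go p r (fwd pRq ◅ q~r) = SameClasses-trans trans (R-compat p _ pRq) (go _ r q~r)
  go p r (bwd qRp ◅ q~r) =
    SameClasses-trans trans (SameClasses-sym sym (R-compat _ p qRp)) (go _ r q~r)

eqClosure-∪-isCongruence : (G : Optiongraph) {σ : Rel (Pos G) ℓ} {τ : Rel (Pos G) ℓ′} →
  IsCompatible G σ → IsCompatible G τ → IsCongruence G (EqClosure (σ ∪ τ))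
eqClosure-∪-isCongruence G {σ} {τ} σ-compat τ-compat =
  EqClosure.isEquivalence (σ ∪ τ) , eqClosure-isCompatible G step
  where
  step : ∀ p q → (σ ∪ τ) p q → SameClasses (EqClosure (σ ∪ τ)) (Opt G p) (Opt G q)
  step p q (inj₁ pσq) = SameClasses-mono (EqClosure.return ∘ inj₁) (σ-compat p q pσq)
  step p q (inj₂ pτq) = SameClasses-mono (EqClosure.return ∘ inj₂) (τ-compat p q pτq)

⋈-maximum : (G : Optiongraph) {θ : Rel (Pos G) 0ℓ} → IsCongruence G θ → θ ⇒ ⋈ G
⋈-maximum G {θ} θ-cong pθq = θ , θ-cong , pθq

⋈-trans : (G : Optiongraph) → Transitive (⋈ G)
⋈-trans G (σ , (_ , σ-compat) , pσq) (τ , (_ , τ-compat) , qτr) =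
  EqClosure (σ ∪ τ) , eqClosure-∪-isCongruence G σ-compat τ-compat ,
  EqClosure.transitive (σ ∪ τ) (EqClosure.return (inj₁ pσq)) (EqClosure.return (inj₂ qτr))

IsOptionPreserving : (D S : Optiongraph) → Rel (Pos S) ℓ → (Pos D → Pos S) → Set ℓ
IsOptionPreserving D S ψ f = ∀ p →
  ((s : Pos S) → Opt S (f p) s → ∃ λ p′ → Opt D p p′ × ψ s (f p′)) ×
  ((p′ : Pos D) → Opt D p p′ → ∃ λ s → Opt S (f p) s × ψ (f p′) s)

isOptionPreserving-mono : {D S : Optiongraph} {ψ : Rel (Pos S) ℓ} {ψ′ : Rel (Pos S) ℓ′}
  {f : Pos D → Pos S} → ψ ⇒ ψ′ → IsOptionPreserving D S ψ f → IsOptionPreserving D S ψ′ f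
isOptionPreserving-mono ψ⇒ψ′ f-opt p =
  (λ s s∈Opt → let p′ , p′∈Opt , s~fp′ = proj₁ (f-opt p) s s∈Opt in p′ , p′∈Opt , ψ⇒ψ′ s~fp′) ,
  (λ p′ p′∈Opt → let s , s∈Opt , fp′~s = proj₂ (f-opt p) p′ p′∈Opt in s , s∈Opt , ψ⇒ψ′ fp′~s)

on-isCongruence : (D S : Optiongraph) {ψ : Rel (Pos S) ℓ} {ρ : Rel (Pos S) ℓ′} {f : Pos D → Pos S} →
  IsOptionPreserving D S ψ f → IsCongruence S ρ → ψ ⇒ ρ → IsCongruence D (ρ on f)
on-isCongruence D S {ψ} {ρ} {f} f-opt (ρ-equiv , ρ-compat) ψ⇒ρ =
  On.isEquivalence f ρ-equiv , compat
  where
  open IsEquivalence ρ-equiv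

  compat : IsCompatible D (ρ on f)
  compat p q fp~fq =
    (λ p′ p′∈Opt → let s , s∈Opt , fp′~s = proj₂ (f-opt p) p′ p′∈Opt
                       t , t∈Opt , s~t = proj₁ (ρ-compat (f p) (f q) fp~fq) s s∈Opt
                       q′ , q′∈Opt , t~fq′ = proj₁ (f-opt q) t t∈Opt
                   in q′ , q′∈Opt , trans (ψ⇒ρ fp′~s) (trans s~t (ψ⇒ρ t~fq′))) ,
    (λ q′ q′∈Opt → let t , t∈Opt , fq′~t = proj₂ (f-opt q) q′ q′∈Opt
                       s , s∈Opt , s~t = proj₂ (ρ-compat (f p) (f q) fp~fq) t t∈Opt
                       p′ , p′∈Opt , s~fp′ = proj₁ (f-opt p) s s∈Opt
                   in p′ , p′∈Opt , trans (sym (ψ⇒ρ s~fp′)) (trans s~t (sym (ψ⇒ρ fq′~t))))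

⋈-reflect : (D S : Optiongraph) {ψ : Rel (Pos S) 0ℓ} {f : Pos D → Pos S} →
  IsOptionPreserving D S ψ f → IsCompatible S ψ →
  ∀ {p q} → ⋈ S (f p) (f q) → ⋈ D p q
⋈-reflect D S {ψ} {f} f-opt ψ-compat (σ , (_ , σ-compat) , fpσfq) =
  (EqClosure (σ ∪ ψ) on f) ,
  on-isCongruence D S f-opt (eqClosure-∪-isCongruence S σ-compat ψ-compat)
    (EqClosure.return ∘ inj₂) ,
  EqClosure.return (inj₁ fpσfq)

module QuotIsoInverse {D S : Optiongraph} {θ : Rel (Pos D) ℓ} {ψ : Rel (Pos S) ℓ′}
                      (ψ-cong : IsCongruence S ψ) (iso : QuotIso D θ S ψ) where
  open QuotIso iso
  open IsEquivalence (proj₁ ψ-cong)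

  g : Pos S → Pos D
  g s = proj₁ (surjective s)

  f∘g≈id : ∀ s → ψ (f (g s)) s
  f∘g≈id s = proj₂ (surjective s)

  g∘f≈id : ∀ p → θ (g (f p)) p
  g∘f≈id p = injective _ _ (f∘g≈id (f p))

  g-isOptionPreserving : IsOptionPreserving S D θ g
  g-isOptionPreserving s =
    (λ p p∈Opt → let t , t∈Opt , fp~t = proj₂ (opt-pres (g s)) p p∈Opt
                     s′ , s′∈Opt , t~s′ = proj₁ (proj₂ ψ-cong _ _ (f∘g≈id s)) t t∈Opt
                 in s′ , s′∈Opt ,
                    injective _ _ (trans fp~t (trans t~s′ (sym (f∘g≈id s′))))) ,
    (λ s′ s′∈Opt → let t , t∈Opt , t~s′ = proj₂ (proj₂ ψ-cong _ _ (f∘g≈id s)) s′ s′∈Opt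
                       p , p∈Opt , t~fp = proj₁ (opt-pres (g s)) t t∈Opt
                   in p , p∈Opt ,
                      injective _ _ (trans (f∘g≈id s′) (trans (sym t~s′) t~fp)))

mainTheorem13 : (D S : Optiongraph) (θ : Rel (Pos D) 0ℓ) (ψ : Rel (Pos S) 0ℓ) →
                  IsCongruence D θ → IsCongruence S ψ →
                  QuotIso D θ S ψ →
                  QuotIso D (⋈ D) S (⋈ S)
mainTheorem13 D S θ ψ θ-cong ψ-cong iso = record
  { f          = f
  ; well-def   = λ p q p⋈q → ⋈-reflect S D g-isOptionPreserving (proj₂ θ-cong)
                   (⋈-trans D (⋈-trans D (θ⊆⋈ (g∘f≈id p)) p⋈q) (θ⊆⋈ (θ-sym (g∘f≈id q))))
  ; injective  = λ p q → ⋈-reflect D S opt-pres (proj₂ ψ-cong)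
  ; surjective = λ s → g s , ψ⊆⋈ (f∘g≈id s)
  ; opt-pres   = isOptionPreserving-mono {D = D} {S = S} {f = f} ψ⊆⋈ opt-pres
  }
  where
  open QuotIso iso
  open QuotIsoInverse ψ-cong iso
  θ-sym : Symmetric θ
  θ-sym = IsEquivalence.sym (proj₁ θ-cong)

  θ⊆⋈ : θ ⇒ ⋈ D
  θ⊆⋈ = ⋈-maximum D θ-cong

  ψ⊆⋈ : ψ ⇒ ⋈ S
  ψ⊆⋈ = ⋈-maximum S ψ-cong
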